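{- Let $a_1, \ldots , a_k$ be non-zero rationals. Assume that no product of the $a_i$ with (possibly negative) integer exponents equals $-1$. Then there exists a set $S \subset \{a_1, \ldots , a_k\}$ with the following properties: (i) the elements of $S$ are multiplicatively independent; (ii) for all $1 \le i \le k$ there exists an odd integer $e$ such that $a_i^e$ may be expressed as a product of the elements of $S$ with (possibly negative) integer exponents.
   Context: Nonzero rationals $s_1,\dots,s_m$ are multiplicatively independent if $s_1^{x_1}\cdots s_m^{x_m} = 1$ with $x_i \in \mathbb{Z}$ implies all $x_i = 0$. -}

module Defs where

open import Data.Nat using (ℕ; zero; suc)
open import Data.Integer using (ℤ; +_; -[1+_])
open import Data.Fin using (Fin; zero; suc)
open import Data.Rational using (ℚ; 1ℚ; _*_; 1/_; NonZero)

_^ℕ_ : ℚ → ℕ → ℚ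
q ^ℕ zero = 1ℚ
q ^ℕ suc n = q * (q ^ℕ n)

zpow : (q : ℚ) → .{{NonZero q}} → ℤ → ℚ
zpow q (+ n) = q ^ℕ n
zpow q -[1+ n ] = (1/ q) ^ℕ suc n

prodFin : (k : ℕ) → (Fin k → ℚ) → ℚ
prodFin zero f = 1ℚ
prodFin (suc k) f = f zero * prodFin k (λ i → f (suc i))

monomial : (k : ℕ) (a : Fin k → ℚ) → (∀ i → NonZero (a i)) → (Fin k → ℤ) → ℚ
monomial k a nz x = prodFin k (λ i → zpow (a i) {{nz i}} (x i))

module Submission where

-- A non-zero rational is determined by its valuations at all primes and its
-- sign (rational-determined), and these are homomorphisms into ℤ and ℤ/2.  Only primes
-- below the height of the aⱼ occur, so the valuations form an integer matrix V whose
-- rows correspond to the aⱼ.  Gaussian elimination over ℤ localised at 2 (eliminate)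
-- yields an independent set S of rows such that every row has an odd multiple in the
-- span of S.  A monomial equal to 1 is a row relation, so independence of the rows
-- gives multiplicative independence.  Conversely e·Vᵢ = Σ yⱼVⱼ makes aᵢᵉ and ∏ aⱼ^{yⱼ}
-- agree in all valuations; since −1 is excluded, every row relation has even sign sum
-- (relation⇒even-sign), so their signs agree as well.

open import Defs
open import Function using (_∘_)
open import Data.Empty using (⊥-elim)
open import Data.Product using (Σ; ∃; _×_; _,_; proj₁; proj₂)
open import Data.Sum using (_⊎_; inj₁; inj₂; [_,_]′)
open import Relation.Nullary using (¬_; yes; no)
open import Relation.Nullary.Decidable using (¬?; decidable-stable)
open import Relation.Unary using (Decidable)
open import Relation.Binary.PropositionalEquality
open ≡-Reasoning
import Data.Nat as ℕ
open ℕ using (ℕ; zero; suc; NonTrivial)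
import Data.Nat.Properties as ℕP
open import Algebra.Properties.CommutativeSemigroup ℕP.*-commutativeSemigroup using () renaming (interchange to ℕ-*-interchange)
open import Data.Integer using (ℤ; +_; -[1+_]; +[1+_]; _+_; _*_; _-_; -_; 0ℤ; 1ℤ; ∣_∣)
import Data.Integer as ℤ
import Data.Integer.Properties as ℤP
open import Data.Integer.Tactic.RingSolver using (solve-∀)
open import Data.Fin using (Fin; zero; suc; toℕ; fromℕ<)
import Data.Fin.Properties as FinP
open import Data.Fin.Subset using (Subset; _∉_; ⁅_⁆; _∪_) renaming (⊥ to ∅)
import Data.Fin.Subset.Properties as SubsetP
import Data.Rational as ℚ
open ℚ using (ℚ; mkℚ; 1ℚ; 1/_; NonZero; ↥_; ↧ₙ_)
import Data.Rational.Properties as ℚP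
import Data.Rational.Unnormalised as ℚᵘ
import Data.Nat.Divisibility as ℕDiv
open import Data.List using ([]; _∷_)
open import Data.List.Relation.Unary.All using (_∷_)
open import Data.Nat.ListAction using (product)
open import Data.Nat.Primality.Factorisation using (factorise)
open import Data.Nat.DivMod using (_%_; _/_; m≡m%n+[m/n]*n; m%n<n)
open import Data.Nat.Primality using (Prime; prime?; prime[2]; euclidsLemma; prime⇒nonTrivial; prime⇒nonZero)

infix 8 _·_
_·_ : ∀ {k} → (Fin k → ℤ) → (Fin k → ℤ) → ℤ
_·_ {zero} x v = 0ℤ
_·_ {suc k} x v = x zero * v zero + (x ∘ suc) · (v ∘ suc)

lc : ∀ {k} → ℤ → (Fin k → ℤ) → ℤ → (Fin k → ℤ) → Fin k → ℤ
lc α x β y j = α * x j + β * y j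

δ : ∀ {k} → Fin k → Fin k → ℤ
δ zero zero = 1ℤ
δ zero (suc j) = 0ℤ
δ (suc i) zero = 0ℤ
δ (suc i) (suc j) = δ i j

δ-diag : ∀ {k} (i : Fin k) → δ i i ≡ 1ℤ
δ-diag zero = refl
δ-diag (suc i) = δ-diag i

δ-off : ∀ {k} {i j : Fin k} → i ≢ j → δ i j ≡ 0ℤ
δ-off {i = zero} {zero} i≢j = ⊥-elim (i≢j refl)
δ-off {i = zero} {suc j} i≢j = refl
δ-off {i = suc i} {zero} i≢j = refl
δ-off {i = suc i} {suc j} i≢j = δ-off (i≢j ∘ cong suc)

·-cong : ∀ {k} {x y v w : Fin k → ℤ} → (∀ j → x j ≡ y j) → (∀ j → v j ≡ w j) → x · v ≡ y · w
·-cong {zero} x≗y v≗w = refl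
·-cong {suc k} x≗y v≗w = cong₂ _+_ (cong₂ _*_ (x≗y zero) (v≗w zero)) (·-cong (x≗y ∘ suc) (v≗w ∘ suc))

·-comm : ∀ {k} (x v : Fin k → ℤ) → x · v ≡ v · x
·-comm {zero} x v = refl
·-comm {suc k} x v = cong₂ _+_ (ℤP.*-comm (x zero) (v zero)) (·-comm (x ∘ suc) (v ∘ suc))

·-zeroˡ : ∀ {k} {x : Fin k → ℤ} (v : Fin k → ℤ) → (∀ j → x j ≡ 0ℤ) → x · v ≡ 0ℤ
·-zeroˡ {zero} v x≗0 = refl
·-zeroˡ {suc k} {x} v x≗0 = begin
  x zero * v zero + (x ∘ suc) · (v ∘ suc) ≡⟨ cong₂ _+_ (cong (_* v zero) (x≗0 zero)) (·-zeroˡ (v ∘ suc) (x≗0 ∘ suc)) ⟩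
  0ℤ * v zero + 0ℤ                         ≡⟨ ℤP.+-identityʳ _ ⟩
  0ℤ * v zero                              ≡⟨ ℤP.*-zeroˡ (v zero) ⟩
  0ℤ                                       ∎

·-zeroʳ : ∀ {k} (x : Fin k → ℤ) {v : Fin k → ℤ} → (∀ j → v j ≡ 0ℤ) → x · v ≡ 0ℤ
·-zeroʳ x {v} v≗0 = trans (·-comm x v) (·-zeroˡ x v≗0)

·-lcˡ : ∀ {k} α (x : Fin k → ℤ) β y v → lc α x β y · v ≡ α * (x · v) + β * (y · v)
·-lcˡ {zero} α x β y v = sym (cong₂ _+_ (ℤP.*-zeroʳ α) (ℤP.*-zeroʳ β))
·-lcˡ {suc k} α x β y v = begin
  (α * x zero + β * y zero) * v zero + lc α (x ∘ suc) β (y ∘ suc) · (v ∘ suc)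
    ≡⟨ cong (_+_ ((α * x zero + β * y zero) * v zero)) (·-lcˡ α (x ∘ suc) β (y ∘ suc) (v ∘ suc)) ⟩
  (α * x zero + β * y zero) * v zero + (α * ((x ∘ suc) · (v ∘ suc)) + β * ((y ∘ suc) · (v ∘ suc)))
    ≡⟨ regroup α β (x zero) (y zero) (v zero) _ _ ⟩
  α * (x zero * v zero + (x ∘ suc) · (v ∘ suc)) + β * (y zero * v zero + (y ∘ suc) · (v ∘ suc)) ∎
  where
  regroup : ∀ α β x y v X Y → (α * x + β * y) * v + (α * X + β * Y) ≡ α * (x * v + X) + β * (y * v + Y)
  regroup = solve-∀

·-lcʳ : ∀ {k} (v : Fin k → ℤ) α x β y → v · lc α x β y ≡ α * (v · x) + β * (v · y)
·-lcʳ v α x β y = begin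
  v · lc α x β y            ≡⟨ ·-comm v _ ⟩
  lc α x β y · v            ≡⟨ ·-lcˡ α x β y v ⟩
  α * (x · v) + β * (y · v) ≡⟨ cong₂ (λ a b → α * a + β * b) (·-comm x v) (·-comm y v) ⟩
  α * (v · x) + β * (v · y) ∎

δ-· : ∀ {k} (i : Fin k) (v : Fin k → ℤ) → δ i · v ≡ v i
δ-· {suc k} zero v = begin
  1ℤ * v zero + (δ zero ∘ suc) · (v ∘ suc) ≡⟨ cong (_+_ (1ℤ * v zero)) (·-zeroˡ (v ∘ suc) (λ _ → refl)) ⟩
  1ℤ * v zero + 0ℤ                        ≡⟨ ℤP.+-identityʳ _ ⟩
  1ℤ * v zero                             ≡⟨ ℤP.*-identityˡ (v zero) ⟩
  v zero                                  ∎
δ-· {suc k} (suc i) v = trans (cong (_+ (δ i · (v ∘ suc))) (ℤP.*-zeroˡ (v zero))) (trans (ℤP.+-identityˡ _) (δ-· i (v ∘ suc)))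

·-*ʳ : ∀ {k} (x : Fin k → ℤ) c (v : Fin k → ℤ) → x · (λ j → c * v j) ≡ c * (x · v)
·-*ʳ {zero} x c v = sym (ℤP.*-zeroʳ c)
·-*ʳ {suc k} x c v = begin
  x zero * (c * v zero) + (x ∘ suc) · (λ j → c * v (suc j)) ≡⟨ cong (_+_ (x zero * (c * v zero))) (·-*ʳ (x ∘ suc) c (v ∘ suc)) ⟩
  x zero * (c * v zero) + c * ((x ∘ suc) · (v ∘ suc))       ≡⟨ factor (x zero) c (v zero) _ ⟩
  c * (x zero * v zero + (x ∘ suc) · (v ∘ suc))             ∎
  where factor : ∀ x c v X → x * (c * v) + c * X ≡ c * (x * v + X)
        factor = solve-∀

subtract-at : ∀ {k} → Fin k → ℤ → (Fin k → ℤ) → Fin k → ℤ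
subtract-at i e y = lc 1ℤ y (- e) (δ i)

·-subtract-at : ∀ {k} (i : Fin k) e y v → subtract-at i e y · v ≡ y · v - e * v i
·-subtract-at i e y v = begin
  subtract-at i e y · v              ≡⟨ ·-lcˡ 1ℤ y (- e) (δ i) v ⟩
  1ℤ * (y · v) + - e * (δ i · v)     ≡⟨ cong (λ c → 1ℤ * (y · v) + - e * c) (δ-· i v) ⟩
  1ℤ * (y · v) + - e * v i           ≡⟨ simplify (y · v) e (v i) ⟩
  y · v - e * v i                    ∎
  where simplify : ∀ Y e c → 1ℤ * Y + - e * c ≡ Y - e * c
        simplify = solve-∀

subtract-at-self : ∀ {k} (i : Fin k) y → subtract-at i (y i) y i ≡ 0ℤ
subtract-at-self i y = trans (cong (λ d → 1ℤ * y i + - y i * d) (δ-diag i)) (cancel (y i))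
  where cancel : ∀ a → 1ℤ * a + - a * 1ℤ ≡ 0ℤ
        cancel = solve-∀

subtract-at-off : ∀ {k} {i j : Fin k} e y → i ≢ j → subtract-at i e y j ≡ y j
subtract-at-off {i = i} {j} e y i≢j = trans (cong (λ d → 1ℤ * y j + - e * d) (δ-off i≢j)) (drop (y j) e)
  where drop : ∀ a e → 1ℤ * a + - e * 0ℤ ≡ a
        drop = solve-∀

-- Congruence of integers modulo M (modulus 0 is plain equality).
infix 4 _≡_[mod_]
record _≡_[mod_] (a b M : ℤ) : Set where
  constructor congruent
  field
    quotient : ℤ
    equation : a ≡ b + M * quotient

module _ {M : ℤ} where

  ≡⇒≡mod : ∀ {a b} → a ≡ b → a ≡ b [mod M ]
  ≡⇒≡mod {a} {b} a≡b = congruent 0ℤ (trans a≡b (sym (trans (cong (_+_ b) (ℤP.*-zeroʳ M)) (ℤP.+-identityʳ b))))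

  mod-sym : ∀ {a b} → a ≡ b [mod M ] → b ≡ a [mod M ]
  mod-sym {a} {b} (congruent t a≡b+Mt) = congruent (- t) (begin
    b                  ≡⟨ shift b M t ⟩
    b + M * t + M * - t ≡⟨ cong (λ c → c + M * - t) (sym a≡b+Mt) ⟩
    a + M * - t        ∎)
    where shift : ∀ b M t → b ≡ b + M * t + M * - t
          shift = solve-∀

  mod-trans : ∀ {a b c} → a ≡ b [mod M ] → b ≡ c [mod M ] → a ≡ c [mod M ]
  mod-trans {a} {b} {c} (congruent t a≡b+Mt) (congruent s b≡c+Ms) = congruent (s + t) (begin
    a                  ≡⟨ a≡b+Mt ⟩
    b + M * t          ≡⟨ cong (λ d → d + M * t) b≡c+Ms ⟩
    c + M * s + M * t  ≡⟨ collect c M s t ⟩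
    c + M * (s + t)    ∎)
    where collect : ∀ c M s t → c + M * s + M * t ≡ c + M * (s + t)
          collect = solve-∀

  mod-+ : ∀ {a b c d} → a ≡ b [mod M ] → c ≡ d [mod M ] → a + c ≡ b + d [mod M ]
  mod-+ {a} {b} {c} {d} (congruent t a≡b+Mt) (congruent s c≡d+Ms) = congruent (t + s) (begin
    a + c                  ≡⟨ cong₂ _+_ a≡b+Mt c≡d+Ms ⟩
    b + M * t + (d + M * s) ≡⟨ collect b d M t s ⟩
    b + d + M * (t + s)    ∎)
    where collect : ∀ b d M t s → b + M * t + (d + M * s) ≡ b + d + M * (t + s)
          collect = solve-∀

  mod-*ˡ : ∀ c {a b} → a ≡ b [mod M ] → c * a ≡ c * b [mod M ]
  mod-*ˡ c {a} {b} (congruent t a≡b+Mt) = congruent (c * t) (begin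
    c * a           ≡⟨ cong (c *_) a≡b+Mt ⟩
    c * (b + M * t) ≡⟨ distribute c b M t ⟩
    c * b + M * (c * t) ∎)
    where distribute : ∀ c b M t → c * (b + M * t) ≡ c * b + M * (c * t)
          distribute = solve-∀

mod0⇒≡ : ∀ {a b} → a ≡ b [mod 0ℤ ] → a ≡ b
mod0⇒≡ {a} {b} (congruent t a≡b+0t) = trans a≡b+0t (trans (cong (_+_ b) (ℤP.*-zeroˡ t)) (ℤP.+-identityʳ b))

IsOdd : ℤ → Set
IsOdd e = ∃ λ (m : ℤ) → e ≡ + 2 * m + + 1

odd-* : ∀ {a b} → IsOdd a → IsOdd b → IsOdd (a * b)
odd-* (m , refl) (n , refl) = + 2 * m * n + m + n , expand m n
  where expand : ∀ m n → (+ 2 * m + + 1) * (+ 2 * n + + 1) ≡ + 2 * (+ 2 * m * n + m + n) + + 1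
        expand = solve-∀

-- An odd integer is non-zero: 2m + 1 = 0 would give 2∣m∣ = 1.
odd≢0 : ∀ {a} → IsOdd a → a ≢ 0ℤ
odd≢0 (m , refl) 2m+1≡0 = 2n≢1 ∣ m ∣ (trans (sym (ℤP.abs-* (+ 2) m)) (cong ∣_∣ 2m≡-1))
  where
  2n≢1 : ∀ n → 2 ℕ.* n ≢ 1
  2n≢1 zero ()
  2n≢1 (suc n) 2+2n≡1 = ℕP.m+1+n≢0 n (ℕP.suc-injective 2+2n≡1)
  isolate : ∀ m → + 2 * m ≡ (+ 2 * m + + 1) - 1ℤ
  isolate = solve-∀
  2m≡-1 : + 2 * m ≡ - 1ℤ
  2m≡-1 = trans (isolate m) (cong (_- 1ℤ) 2m+1≡0)

Bit : ℤ → Set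
Bit a = a ≡ 0ℤ ⊎ a ≡ 1ℤ

bits-mod2 : ∀ {a b} → Bit a → Bit b → a ≡ b [mod + 2 ] → a ≡ b
bits-mod2 (inj₁ refl) (inj₁ refl) _ = refl
bits-mod2 (inj₂ refl) (inj₂ refl) _ = refl
bits-mod2 (inj₁ refl) (inj₂ refl) (congruent t 0≡1+2t) = ⊥-elim (odd≢0 (t , ℤP.+-comm (+ 1) (+ 2 * t)) (sym 0≡1+2t))
bits-mod2 (inj₂ refl) (inj₁ refl) (congruent t 1≡0+2t) = ⊥-elim (odd≢0 (- t , refl) (begin
  + 2 * - t + 1ℤ          ≡⟨ cong (λ c → + 2 * - t + c) 1≡0+2t ⟩
  + 2 * - t + (0ℤ + + 2 * t) ≡⟨ cancel t ⟩
  0ℤ                      ∎))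
  where cancel : ∀ t → + 2 * - t + (0ℤ + + 2 * t) ≡ 0ℤ
        cancel = solve-∀

cancel-≢0 : ∀ {a x} → a ≢ 0ℤ → a * x ≡ 0ℤ → x ≡ 0ℤ
cancel-≢0 {a} a≢0 ax≡0 = [ ⊥-elim ∘ a≢0 , (λ x≡0 → x≡0) ]′ (ℤP.i*j≡0⇒i≡0∨j≡0 a ax≡0)

subtract-at-orthogonal : ∀ {k M} (i : Fin k) e y v → subtract-at i e y · v ≡ 0ℤ [mod M ] → e * v i ≡ y · v [mod M ]
subtract-at-orthogonal {M = M} i e y v (congruent t orth) = congruent (- t) (begin
  e * v i                  ≡⟨ isolate (y · v) (e * v i) ⟩
  y · v - (y · v - e * v i) ≡⟨ cong (λ c → y · v - c) (trans (sym (·-subtract-at i e y v)) orth) ⟩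
  y · v - (0ℤ + M * t)     ≡⟨ negate (y · v) M t ⟩
  y · v + M * - t          ∎)
  where isolate : ∀ Y E → E ≡ Y - (Y - E)
        isolate = solve-∀
        negate : ∀ Y M t → Y - (0ℤ + M * t) ≡ Y + M * - t
        negate = solve-∀

-- The multiplicity of a base p > 1 in a natural number.
module Valuation (p : ℕ) .{{p>1 : NonTrivial p}} where

  instance
    p-nonZero : ℕ.NonZero p
    p-nonZero = ℕ.nonTrivial⇒nonZero p

  Split : ℕ → Set
  Split n = Σ ℕ λ e → Σ ℕ λ m → n ≡ p ℕ.^ e ℕ.* m × ¬ (p ℕDiv.∣ m)

  -- Dividing out p repeatedly; `bound` is fuel exceeding the number of divisions.
  split-bounded : ∀ bound n → n ≢ 0 → n ℕ.≤ bound → Split n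
  split-bounded bound n n≢0 n≤bound with p ℕDiv.∣? n
  ... | no p∤n = 0 , n , sym (ℕP.*-identityˡ n) , p∤n
  split-bounded zero n n≢0 n≤0 | yes _ = ⊥-elim (n≢0 (ℕP.n≤0⇒n≡0 n≤0))
  split-bounded (suc bound) n n≢0 n≤1+bound | yes (ℕDiv.divides q n≡q*p) =
    let (e , m , q≡pᵉm , p∤m) = split-bounded bound q q≢0 q≤bound
    in suc e , m , (begin
      n                       ≡⟨ n≡q*p ⟩
      q ℕ.* p                 ≡⟨ cong (ℕ._* p) q≡pᵉm ⟩
      p ℕ.^ e ℕ.* m ℕ.* p     ≡⟨ ℕP.*-comm (p ℕ.^ e ℕ.* m) p ⟩
      p ℕ.* (p ℕ.^ e ℕ.* m)   ≡⟨ sym (ℕP.*-assoc p (p ℕ.^ e) m) ⟩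
      p ℕ.* p ℕ.^ e ℕ.* m     ∎) , p∤m
    where
    q≢0 : q ≢ 0
    q≢0 q≡0 = n≢0 (trans n≡q*p (cong (ℕ._* p) q≡0))
    q<n : q ℕ.< n
    q<n = subst (q ℕ.<_) (sym n≡q*p) (ℕP.m<m*n q p {{ℕ.≢-nonZero q≢0}} (ℕ.nonTrivial⇒n>1 p))
    q≤bound : q ℕ.≤ bound
    q≤bound = ℕP.≤-pred (ℕP.≤-trans q<n n≤1+bound)

  split : ∀ n → n ≢ 0 → Split n
  split n n≢0 = split-bounded n n n≢0 ℕP.≤-refl

  split-unique : ∀ e f m m' → p ℕ.^ e ℕ.* m ≡ p ℕ.^ f ℕ.* m' → ¬ p ℕDiv.∣ m → ¬ p ℕDiv.∣ m' → e ≡ f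
  split-unique zero zero m m' _ _ _ = refl
  split-unique zero (suc f) m m' eq p∤m _ =
    ⊥-elim (p∤m (ℕDiv.divides (p ℕ.^ f ℕ.* m') (trans (sym (ℕP.*-identityˡ m)) (trans eq (pull-out-p f m')))))
    where pull-out-p : ∀ f m → p ℕ.* p ℕ.^ f ℕ.* m ≡ p ℕ.^ f ℕ.* m ℕ.* p
          pull-out-p f m = trans (ℕP.*-assoc p (p ℕ.^ f) m) (ℕP.*-comm p (p ℕ.^ f ℕ.* m))
  split-unique (suc e) zero m m' eq p∤m p∤m' = sym (split-unique zero (suc e) m' m (sym eq) p∤m' p∤m)
  split-unique (suc e) (suc f) m m' eq p∤m p∤m' = cong suc (split-unique e f m m'
    (ℕP.*-cancelˡ-≡ _ _ p (trans (sym (ℕP.*-assoc p (p ℕ.^ e) m)) (trans eq (ℕP.*-assoc p (p ℕ.^ f) m')))) p∤m p∤m')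

  -- The valuation: the exponent of p in n (by convention 0 for n = 0).
  val : ℕ → ℕ
  val zero = 0
  val (suc n) = proj₁ (split (suc n) (λ ()))

  val-split : ∀ n → n ≢ 0 → Σ ℕ λ m → n ≡ p ℕ.^ val n ℕ.* m × ¬ (p ℕDiv.∣ m)
  val-split zero n≢0 = ⊥-elim (n≢0 refl)
  val-split (suc n) _ = proj₂ (split (suc n) (λ ()))

  val-spec : ∀ {n} → n ≢ 0 → ∀ e m → n ≡ p ℕ.^ e ℕ.* m → ¬ p ℕDiv.∣ m → val n ≡ e
  val-spec {n} n≢0 e m n≡pᵉm p∤m =
    let (m' , n≡pᵛm' , p∤m') = val-split n n≢0
    in split-unique (val n) e m' m (trans (sym n≡pᵛm') n≡pᵉm) p∤m' p∤m

  val-indivisible : ∀ {n} → n ≢ 0 → ¬ p ℕDiv.∣ n → val n ≡ 0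
  val-indivisible {n} n≢0 p∤n = val-spec n≢0 0 n (sym (ℕP.*-identityˡ n)) p∤n

  val-1 : val 1 ≡ 0
  val-1 = val-indivisible (λ ()) (λ p∣1 → ℕ.nonTrivial⇒≢1 (ℕDiv.∣1⇒≡1 p∣1))

  val-small : ∀ {n} → n ≢ 0 → n ℕ.< p → val n ≡ 0
  val-small {n} n≢0 n<p = val-indivisible n≢0 (λ p∣n → ℕP.<⇒≱ n<p (ℕDiv.∣⇒≤ {{ℕ.≢-nonZero n≢0}} p∣n))

  val≢0⇒∣ : ∀ {n} → n ≢ 0 → val n ≢ 0 → p ℕDiv.∣ n
  val≢0⇒∣ {n} n≢0 v≢0 with val n | val-split n n≢0
  ... | zero  | _ = ⊥-elim (v≢0 refl)
  ... | suc e | m , n≡pᵉ⁺¹m , _ =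
    ℕDiv.divides (p ℕ.^ e ℕ.* m) (trans n≡pᵉ⁺¹m (trans (ℕP.*-assoc p (p ℕ.^ e) m) (ℕP.*-comm p (p ℕ.^ e ℕ.* m))))

  ∣⇒val≢0 : ∀ {n} → n ≢ 0 → p ℕDiv.∣ n → val n ≢ 0
  ∣⇒val≢0 {n} n≢0 p∣n v≡0 with val-split n n≢0
  ... | m , n≡pᵛm , p∤m = p∤m (subst (p ℕDiv.∣_) (trans n≡pᵛm (trans (cong (λ v → p ℕ.^ v ℕ.* m) v≡0) (ℕP.*-identityˡ m))) p∣n)

  -- At a prime, the valuation turns products into sums (Euclid's lemma).
  val-* : Prime p → ∀ {m n} → m ≢ 0 → n ≢ 0 → val (m ℕ.* n) ≡ val m ℕ.+ val n
  val-* p-prime {m} {n} m≢0 n≢0 =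
    let (m' , m≡pᵃm' , p∤m') = val-split m m≢0
        (n' , n≡pᵇn' , p∤n') = val-split n n≢0
    in val-spec (mn≢0) (val m ℕ.+ val n) (m' ℕ.* n') (begin
         m ℕ.* n                                               ≡⟨ cong₂ ℕ._*_ m≡pᵃm' n≡pᵇn' ⟩
         p ℕ.^ val m ℕ.* m' ℕ.* (p ℕ.^ val n ℕ.* n')           ≡⟨ ℕ-*-interchange (p ℕ.^ val m) m' (p ℕ.^ val n) n' ⟩
         p ℕ.^ val m ℕ.* p ℕ.^ val n ℕ.* (m' ℕ.* n')           ≡⟨ cong (ℕ._* (m' ℕ.* n')) (sym (ℕP.^-distribˡ-+-* p (val m) (val n))) ⟩
         p ℕ.^ (val m ℕ.+ val n) ℕ.* (m' ℕ.* n')               ∎)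
       (λ p∣m'n' → [ p∤m' , p∤n' ]′ (euclidsLemma m' n' p-prime p∣m'n'))
    where
    mn≢0 : m ℕ.* n ≢ 0
    mn≢0 mn≡0 = [ m≢0 , n≢0 ]′ (ℕP.m*n≡0⇒m≡0∨n≡0 m mn≡0)

module AtPrime {p : ℕ} (p-prime : Prime p) = Valuation p {{prime⇒nonTrivial p-prime}}

prime-factor : ∀ {n} → n ≢ 0 → n ≢ 1 → ∃ λ p → Prime p × p ℕDiv.∣ n
prime-factor {n} n≢0 n≢1 with factorise n {{ℕ.≢-nonZero n≢0}}
... | record { factors = [] ; isFactorisation = n≡1 } = ⊥-elim (n≢1 n≡1)
... | record { factors = p ∷ ps ; isFactorisation = n≡p*Πps ; factorsPrime = p-prime ∷ _ } =
  p , p-prime , ℕDiv.divides (product ps) (trans n≡p*Πps (ℕP.*-comm p (product ps)))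

SameValuations : ℕ → ℕ → Set
SameValuations m n = ∀ {p} (p-prime : Prime p) → AtPrime.val p-prime m ≡ AtPrime.val p-prime n

same-valuations-÷ : ∀ {p m m' n n'} → Prime p → m' ≢ 0 → n' ≢ 0 →
  m ≡ m' ℕ.* p → n ≡ n' ℕ.* p → SameValuations m n → SameValuations m' n'
same-valuations-÷ {p} {m} {m'} {n} {n'} p-prime m'≢0 n'≢0 m≡m'p n≡n'p same {r} r-prime =
  ℕP.+-cancelʳ-≡ (val p) (val m') (val n') (begin
    val m' ℕ.+ val p  ≡⟨ sym (val-* r-prime m'≢0 p≢0) ⟩
    val (m' ℕ.* p)    ≡⟨ cong val (sym m≡m'p) ⟩
    val m             ≡⟨ same r-prime ⟩
    val n             ≡⟨ cong val n≡n'p ⟩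
    val (n' ℕ.* p)    ≡⟨ val-* r-prime n'≢0 p≢0 ⟩
    val n' ℕ.+ val p  ∎)
  where
  open AtPrime r-prime using (val; val-*)
  p≢0 : p ≢ 0
  p≢0 = ℕ.≢-nonZero⁻¹ p {{prime⇒nonZero p-prime}}

-- A non-zero natural number is determined by its valuations at all primes:
-- strip a common prime factor and recurse on the (smaller) quotients.
valuations-determine : ∀ {m n} → m ≢ 0 → n ≢ 0 → SameValuations m n → m ≡ n
valuations-determine {m} = go (suc m) m ℕP.≤-refl
  where
  go : ∀ fuel m → m ℕ.< fuel → ∀ {n} → m ≢ 0 → n ≢ 0 → SameValuations m n → m ≡ n
  go (suc fuel) m (ℕ.s≤s m≤fuel) {n} m≢0 n≢0 same with m ℕ.≟ 1 | n ℕ.≟ 1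
  ... | yes refl | yes n≡1 = sym n≡1
  ... | yes refl | no n≢1 with prime-factor n≢0 n≢1
  ...   | p , p-prime , p∣n =
    ⊥-elim (AtPrime.∣⇒val≢0 p-prime n≢0 p∣n (trans (sym (same p-prime)) (AtPrime.val-1 p-prime)))
  go (suc fuel) m (ℕ.s≤s m≤fuel) {n} m≢0 n≢0 same | no m≢1 | _ with prime-factor m≢0 m≢1
  ... | p , p-prime , p∣m@(ℕDiv.divides m' m≡m'p)
    with AtPrime.val≢0⇒∣ p-prime n≢0 (AtPrime.∣⇒val≢0 p-prime m≢0 p∣m ∘ trans (same p-prime))
  ...   | ℕDiv.divides n' n≡n'p = begin
    m        ≡⟨ m≡m'p ⟩
    m' ℕ.* p ≡⟨ cong (ℕ._* p) (go fuel m' (ℕP.<-≤-trans m'<m m≤fuel) m'≢0 n'≢0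
                  (same-valuations-÷ p-prime m'≢0 n'≢0 m≡m'p n≡n'p same)) ⟩
    n' ℕ.* p ≡⟨ sym n≡n'p ⟩
    n        ∎
    where
    m'≢0 : m' ≢ 0
    m'≢0 m'≡0 = m≢0 (trans m≡m'p (cong (ℕ._* p) m'≡0))
    n'≢0 : n' ≢ 0
    n'≢0 n'≡0 = n≢0 (trans n≡n'p (cong (ℕ._* p) n'≡0))
    m'<m : m' ℕ.< m
    m'<m = subst (m' ℕ.<_) (sym m≡m'p)
             (ℕP.m<m*n m' p {{ℕ.≢-nonZero m'≢0}} (ℕ.nonTrivial⇒n>1 p {{prime⇒nonTrivial p-prime}}))

v₂ : ℤ → ℕ
v₂ c = AtPrime.val prime[2] ∣ c ∣

odd-neg : ∀ {u} → IsOdd u → IsOdd (- u)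
odd-neg (m , refl) = - m - 1ℤ , negate m
  where negate : ∀ m → - (+ 2 * m + + 1) ≡ + 2 * (- m - 1ℤ) + + 1
        negate = solve-∀

indivisible⇒odd : ∀ {m} → ¬ 2 ℕDiv.∣ m → IsOdd (+ m)
indivisible⇒odd {m} 2∤m with m % 2 | m%n<n m 2 | m≡m%n+[m/n]*n m 2
... | 0 | _ | m≡[m/2]*2 = ⊥-elim (2∤m (ℕDiv.divides (m / 2) m≡[m/2]*2))
... | 1 | _ | m≡1+[m/2]*2 = + (m / 2) , (begin
  + m                      ≡⟨ cong +_ m≡1+[m/2]*2 ⟩
  + (1 ℕ.+ m / 2 ℕ.* 2)    ≡⟨ ℤP.pos-+ 1 (m / 2 ℕ.* 2) ⟩
  + 1 + + (m / 2 ℕ.* 2)    ≡⟨ cong (_+_ (+ 1)) (ℤP.pos-* (m / 2) 2) ⟩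
  + 1 + + (m / 2) * + 2    ≡⟨ reorder (+ (m / 2)) ⟩
  + 2 * + (m / 2) + + 1    ∎)
  where reorder : ∀ q → + 1 + q * + 2 ≡ + 2 * q + + 1
        reorder = solve-∀
... | suc (suc _) | ℕ.s≤s (ℕ.s≤s ()) | _

odd-part : ∀ {c} → c ≢ 0ℤ → ∃ λ u → IsOdd u × c ≡ + (2 ℕ.^ v₂ c) * u
odd-part {c} c≢0 =
  let (m , ∣c∣≡2ᵛm , 2∤m) = AtPrime.val-split prime[2] ∣ c ∣ (c≢0 ∘ ℤP.∣i∣≡0⇒i≡0)
      ∣c∣≡2ᵛ*m = trans (cong +_ ∣c∣≡2ᵛm) (ℤP.pos-* (2 ℕ.^ v₂ c) m)
  in signed c (indivisible⇒odd 2∤m) ∣c∣≡2ᵛ*m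
  where
  signed : ∀ c {u} → IsOdd u → + ∣ c ∣ ≡ + (2 ℕ.^ v₂ c) * u → ∃ λ u → IsOdd u × c ≡ + (2 ℕ.^ v₂ c) * u
  signed (+ n) u-odd eq = _ , u-odd , eq
  signed -[1+ n ] {u} u-odd eq = - u , odd-neg u-odd , trans (cong -_ eq) (ℤP.neg-distribʳ-* (+ (2 ℕ.^ v₂ -[1+ n ])) u)

v₂-divides : ∀ {c} t → (c ≢ 0ℤ → t ℕ.≤ v₂ c) → ∃ λ q → c ≡ + (2 ℕ.^ t) * q
v₂-divides {c} t t≤v with c ℤ.≟ 0ℤ
... | yes c≡0 = 0ℤ , trans c≡0 (sym (ℤP.*-zeroʳ (+ (2 ℕ.^ t))))
... | no c≢0 with odd-part c≢0
...   | u , _ , c≡2ᵛu = + (2 ℕ.^ (v₂ c ℕ.∸ t)) * u , (begin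
    c                                              ≡⟨ c≡2ᵛu ⟩
    + (2 ℕ.^ v₂ c) * u                             ≡⟨ cong (λ e → + (2 ℕ.^ e) * u) (sym (ℕP.m+[n∸m]≡n (t≤v c≢0))) ⟩
    + (2 ℕ.^ (t ℕ.+ (v₂ c ℕ.∸ t))) * u             ≡⟨ cong (λ e → + e * u) (ℕP.^-distribˡ-+-* 2 t (v₂ c ℕ.∸ t)) ⟩
    + (2 ℕ.^ t ℕ.* 2 ℕ.^ (v₂ c ℕ.∸ t)) * u          ≡⟨ cong (_* u) (ℤP.pos-* (2 ℕ.^ t) _) ⟩
    + (2 ℕ.^ t) * + (2 ℕ.^ (v₂ c ℕ.∸ t)) * u       ≡⟨ ℤP.*-assoc (+ (2 ℕ.^ t)) _ u ⟩
    + (2 ℕ.^ t) * (+ (2 ℕ.^ (v₂ c ℕ.∸ t)) * u)     ∎)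

-- Integer matrices V : Fin k → Fin n → ℤ are read as k row vectors; col V r is column r.
col : ∀ {k n} → (Fin k → Fin n → ℤ) → Fin n → Fin k → ℤ
col V r j = V j r

SupportedOn : ∀ {k} → Subset k → (Fin k → ℤ) → Set
SupportedOn S x = ∀ j → j ∉ S → x j ≡ 0ℤ

IsRelation : ∀ {k n} → (Fin k → Fin n → ℤ) → (Fin k → ℤ) → Set
IsRelation V x = ∀ r → x · col V r ≡ 0ℤ

Independent : ∀ {k n} → (Fin k → Fin n → ℤ) → Subset k → Set
Independent V S = ∀ x → SupportedOn S x → IsRelation V x → ∀ j → x j ≡ 0ℤ

OddlySpanned : ∀ {k n} → (Fin k → Fin n → ℤ) → Subset k → Set
OddlySpanned V S = ∀ i → ∃ λ e → IsOdd e × ∃ λ y → SupportedOn S y × ∀ r → e * V i r ≡ y · col V r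

∉-insert : ∀ {k} {i j : Fin k} (S : Subset k) → j ∉ ⁅ i ⁆ ∪ S → j ≢ i × j ∉ S
∉-insert {i = i} S j∉ = (λ { refl → j∉ (SubsetP.p⊆p∪q S (SubsetP.x∈⁅x⁆ i)) }) , j∉ ∘ SubsetP.q⊆p∪q ⁅ i ⁆ S

∉-insert⁻ : ∀ {k} {i j : Fin k} (S : Subset k) → j ≢ i → j ∉ S → j ∉ ⁅ i ⁆ ∪ S
∉-insert⁻ {i = i} S j≢i j∉S j∈ = [ j≢i ∘ SubsetP.x∈⁅y⁆⇒x≡y i , j∉S ]′ (SubsetP.x∈p∪q⁻ ⁅ i ⁆ S j∈)

argmin : ∀ {k} (P : Fin k → Set) → Decidable P → (f : Fin k → ℕ) →
  (∀ i → ¬ P i) ⊎ ∃ λ i₀ → P i₀ × (∀ i → P i → f i₀ ℕ.≤ f i)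
argmin {zero} P P? f = inj₁ (λ ())
argmin {suc k} P P? f with argmin (P ∘ suc) (P? ∘ suc) (f ∘ suc) | P? zero
... | inj₁ none | no ¬P0 = inj₁ λ { zero → ¬P0 ; (suc i) → none i }
... | inj₁ none | yes P0 = inj₂ (zero , P0 , λ { zero _ → ℕP.≤-refl ; (suc i) Pi → ⊥-elim (none i Pi) })
... | inj₂ (i₁ , Pi₁ , min₁) | no ¬P0 = inj₂ (suc i₁ , Pi₁ , λ { zero P0 → ⊥-elim (¬P0 P0) ; (suc i) Pi → min₁ i Pi })
... | inj₂ (i₁ , Pi₁ , min₁) | yes P0 with f zero ℕ.≤? f (suc i₁)
...   | yes f0≤ = inj₂ (zero , P0 , λ { zero _ → ℕP.≤-refl ; (suc i) Pi → ℕP.≤-trans f0≤ (min₁ i Pi) })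
...   | no f0≰ = inj₂ (suc i₁ , Pi₁ , λ { zero _ → ℕP.<⇒≤ (ℕP.≰⇒> f0≰) ; (suc i) Pi → min₁ i Pi })

drop-zero-column : ∀ {k n} (V : Fin k → Fin (suc n) → ℤ) (S : Subset k) → (∀ i → V i zero ≡ 0ℤ) →
  Independent (λ j r → V j (suc r)) S × OddlySpanned (λ j r → V j (suc r)) S →
  Independent V S × OddlySpanned V S
drop-zero-column V S column₀≡0 (indep , spanned) =
  (λ x x-supp x-rel → indep x x-supp (x-rel ∘ suc)) ,
  λ i → let (e , e-odd , y , y-supp , rows) = spanned i in e , e-odd , y , y-supp , λ
    { zero → trans (cong (e *_) (column₀≡0 i)) (trans (ℤP.*-zeroʳ e) (sym (·-zeroʳ y column₀≡0)))
    ; (suc r) → rows r }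

-- The pivot
-- entry V i₀ 0 = 2ᵗu (u odd) has minimal 2-adic valuation in column 0, so every
-- entry of that column is 2ᵗqⱼ.  Replacing each row j by u·Vⱼ − qⱼ·V_{i₀} clears
-- column 0; independence and odd spanning for the reduced matrix W lift back to V
-- once the pivot row is added.
module Pivot {k n} (V : Fin k → Fin (suc n) → ℤ) (i₀ : Fin k) (t : ℕ) (u : ℤ) (q : Fin k → ℤ)
  (u-odd : IsOdd u) (pivot : V i₀ zero ≡ + (2 ℕ.^ t) * u)
  (column₀ : ∀ j → V j zero ≡ + (2 ℕ.^ t) * q j) where

  2ᵗ : ℤ
  2ᵗ = + (2 ℕ.^ t)

  2ᵗ≢0 : 2ᵗ ≢ 0ℤ
  2ᵗ≢0 2ᵗ≡0 with ℕP.m^n≡0⇒m≡0 2 t (ℤP.+-injective 2ᵗ≡0)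
  ... | ()

  V' : Fin k → Fin n → ℤ
  V' j r = V j (suc r)

  W : Fin k → Fin n → ℤ
  W j r = lc u (col V' r) (- V' i₀ r) q j

  ·-column₀ : ∀ z → z · col V zero ≡ 2ᵗ * (z · q)
  ·-column₀ z = trans (·-cong (λ _ → refl) column₀) (·-*ʳ z 2ᵗ q)

  ·-W : ∀ z r → z · col W r ≡ u * (z · col V' r) + - V' i₀ r * (z · q)
  ·-W z r = ·-lcʳ z u (col V' r) (- V' i₀ r) q

  -- Clearing the pivot coordinate of a relation of V supported on ⁅ i₀ ⁆ ∪ S' gives
  -- a relation of W supported on S'; it vanishes, and then so does the pivot coordinate.
  lift-independent : ∀ S' → Independent W S' → Independent V (⁅ i₀ ⁆ ∪ S')
  lift-independent S' W-indep x x-supp x-rel j = x≡0 j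
    where
    x' : Fin k → ℤ
    x' = subtract-at i₀ (x i₀) x

    x'-supp : SupportedOn S' x'
    x'-supp j j∉S' with j FinP.≟ i₀
    ... | yes refl = subtract-at-self i₀ x
    ... | no j≢i₀ = trans (subtract-at-off (x i₀) x (j≢i₀ ∘ sym)) (x-supp j (∉-insert⁻ S' j≢i₀ j∉S'))

    ·-x' : ∀ v → x' · v ≡ x · v - x i₀ * v i₀
    ·-x' = ·-subtract-at i₀ (x i₀) x

    -- Column 0 of the relation, divided by 2ᵗ.
    balance : x' · q + u * x i₀ ≡ 0ℤ
    balance = cancel-≢0 2ᵗ≢0 (begin
      2ᵗ * (x' · q + u * x i₀)                        ≡⟨ ℤP.*-distribˡ-+ 2ᵗ (x' · q) (u * x i₀) ⟩
      2ᵗ * (x' · q) + 2ᵗ * (u * x i₀)                  ≡⟨ cong (_+ 2ᵗ * (u * x i₀)) (sym (·-column₀ x')) ⟩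
      x' · col V zero + 2ᵗ * (u * x i₀)                ≡⟨ cong (_+ 2ᵗ * (u * x i₀)) (·-x' (col V zero)) ⟩
      x · col V zero - x i₀ * V i₀ zero + 2ᵗ * (u * x i₀) ≡⟨ cong₂ (λ a b → a - x i₀ * b + 2ᵗ * (u * x i₀)) (x-rel zero) pivot ⟩
      0ℤ - x i₀ * (2ᵗ * u) + 2ᵗ * (u * x i₀)           ≡⟨ cancel (x i₀) 2ᵗ u ⟩
      0ℤ                                               ∎)
      where cancel : ∀ a P u → 0ℤ - a * (P * u) + P * (u * a) ≡ 0ℤ
            cancel = solve-∀

    x'-rel : IsRelation W x'
    x'-rel r = begin
      x' · col W r                                          ≡⟨ ·-W x' r ⟩
      u * (x' · col V' r) + - V' i₀ r * (x' · q)            ≡⟨ cong (λ a → u * a + - V' i₀ r * (x' · q)) (·-x' (col V' r)) ⟩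
      u * (x · col V' r - x i₀ * V' i₀ r) + - V' i₀ r * (x' · q) ≡⟨ cong (λ a → u * (a - x i₀ * V' i₀ r) + - V' i₀ r * (x' · q)) (x-rel (suc r)) ⟩
      u * (0ℤ - x i₀ * V' i₀ r) + - V' i₀ r * (x' · q)      ≡⟨ factor u (x i₀) (V' i₀ r) (x' · q) ⟩
      - V' i₀ r * (x' · q + u * x i₀)                        ≡⟨ cong (- V' i₀ r *_) balance ⟩
      - V' i₀ r * 0ℤ                                         ≡⟨ ℤP.*-zeroʳ (- V' i₀ r) ⟩
      0ℤ                                                     ∎
      where factor : ∀ u a v Q → u * (0ℤ - a * v) + - v * Q ≡ - v * (Q + u * a)
            factor = solve-∀

    x'≡0 : ∀ j → x' j ≡ 0ℤ
    x'≡0 = W-indep x' x'-supp x'-rel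

    x≡0 : ∀ j → x j ≡ 0ℤ
    x≡0 j with j FinP.≟ i₀
    ... | yes refl = cancel-≢0 (odd≢0 u-odd) (begin
      u * x i₀           ≡⟨ sym (ℤP.+-identityˡ (u * x i₀)) ⟩
      0ℤ + u * x i₀      ≡⟨ cong (_+ u * x i₀) (sym (·-zeroˡ q x'≡0)) ⟩
      x' · q + u * x i₀  ≡⟨ balance ⟩
      0ℤ                 ∎)
    ... | no j≢i₀ = trans (sym (subtract-at-off (x i₀) x (j≢i₀ ∘ sym))) (x'≡0 j)

  -- e·Wᵢ = y·W rearranges to (e u)·Vᵢ = (u y + μ δ_{i₀})·V.
  lift-spanned : ∀ S' → OddlySpanned W S' → OddlySpanned V (⁅ i₀ ⁆ ∪ S')
  lift-spanned S' W-spanned i with W-spanned i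
  ... | e , e-odd , y , y-supp , e·Wᵢ≡y·W = e * u , odd-* e-odd u-odd , Y , Y-supp , rows
    where
    μ : ℤ
    μ = e * q i - y · q

    Y : Fin k → ℤ
    Y = lc u y μ (δ i₀)

    Y-supp : SupportedOn (⁅ i₀ ⁆ ∪ S') Y
    Y-supp j j∉S = let (j≢i₀ , j∉S') = ∉-insert S' j∉S in begin
      u * y j + μ * δ i₀ j ≡⟨ cong₂ (λ a b → u * a + μ * b) (y-supp j j∉S') (δ-off (j≢i₀ ∘ sym)) ⟩
      u * 0ℤ + μ * 0ℤ      ≡⟨ cong₂ _+_ (ℤP.*-zeroʳ u) (ℤP.*-zeroʳ μ) ⟩
      0ℤ                   ∎

    ·-Y : ∀ v → Y · v ≡ u * (y · v) + μ * v i₀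
    ·-Y v = trans (·-lcˡ u y μ (δ i₀) v) (cong (λ a → u * (y · v) + μ * a) (δ-· i₀ v))

    rows : ∀ r → e * u * V i r ≡ Y · col V r
    rows zero = sym (begin
      Y · col V zero                          ≡⟨ ·-Y (col V zero) ⟩
      u * (y · col V zero) + μ * V i₀ zero     ≡⟨ cong₂ (λ a b → u * a + μ * b) (·-column₀ y) pivot ⟩
      u * (2ᵗ * (y · q)) + μ * (2ᵗ * u)        ≡⟨ collect e u 2ᵗ (q i) (y · q) ⟩
      e * u * (2ᵗ * q i)                      ≡⟨ cong (e * u *_) (sym (column₀ i)) ⟩
      e * u * V i zero                        ∎)
      where collect : ∀ e u P qᵢ B → u * (P * B) + (e * qᵢ - B) * (P * u) ≡ e * u * (P * qᵢ)
            collect = solve-∀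
    rows (suc r) = begin
      e * u * V' i r                                    ≡⟨ expand e u (V' i r) (q i) (V' i₀ r) ⟩
      e * (u * V' i r + - V' i₀ r * q i) + e * q i * V' i₀ r ≡⟨ cong (_+ e * q i * V' i₀ r) (trans (e·Wᵢ≡y·W r) (·-W y r)) ⟩
      u * (y · col V' r) + - V' i₀ r * (y · q) + e * q i * V' i₀ r ≡⟨ collect u (y · col V' r) (V' i₀ r) (y · q) e (q i) ⟩
      u * (y · col V' r) + μ * V' i₀ r                  ≡⟨ sym (·-Y (col V' r)) ⟩
      Y · col V' r                                      ∎
      where expand : ∀ e u a qᵢ b → e * u * a ≡ e * (u * a + - b * qᵢ) + e * qᵢ * b
            expand = solve-∀
            collect : ∀ u A b B e qᵢ → u * A + - b * B + e * qᵢ * b ≡ u * A + (e * qᵢ - B) * b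
            collect = solve-∀

-- Induction on the number of columns; in the
-- step the pivot of column 0 is a non-zero entry of minimal 2-adic valuation.
eliminate : ∀ n {k} (V : Fin k → Fin n → ℤ) → ∃ λ S → Independent V S × OddlySpanned V S
eliminate zero V = ∅ , (λ x x-supp _ j → x-supp j SubsetP.∉⊥) ,
  λ i → 1ℤ , (0ℤ , refl) , (λ _ → 0ℤ) , (λ _ _ → refl) , λ ()
eliminate (suc n) V with argmin (λ i → V i zero ≢ 0ℤ) (λ i → ¬? (V i zero ℤ.≟ 0ℤ)) (v₂ ∘ col V zero)
... | inj₁ column₀-zero with eliminate n (λ j r → V j (suc r))
...   | S , rest = S , drop-zero-column V S (λ i → decidable-stable (V i zero ℤ.≟ 0ℤ) (column₀-zero i)) rest
eliminate (suc n) V | inj₂ (i₀ , pivot≢0 , minimal) = pivot-step (odd-part pivot≢0)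
  where
  t : ℕ
  t = v₂ (V i₀ zero)

  quotient : ∀ j → ∃ λ q → V j zero ≡ + (2 ℕ.^ t) * q
  quotient j = v₂-divides t (minimal j)

  pivot-step : (∃ λ u → IsOdd u × V i₀ zero ≡ + (2 ℕ.^ t) * u) → ∃ λ S → Independent V S × OddlySpanned V S
  pivot-step (u , u-odd , pivot) with eliminate n (Pivot.W V i₀ t u (proj₁ ∘ quotient) u-odd pivot (proj₂ ∘ quotient))
  ... | S' , W-indep , W-spanned = ⁅ i₀ ⁆ ∪ S' , lift-independent S' W-indep , lift-spanned S' W-spanned
    where open Pivot V i₀ t u (proj₁ ∘ quotient) u-odd pivot (proj₂ ∘ quotient)

-- A rational is non-zero exactly when its numerator is; this form is closed under
-- products without instance bookkeeping.
NumNonZero : ℚ → Set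
NumNonZero q = ↥ q ≢ 0ℤ

↥*↧ : ∀ q r → ↥ (q ℚ.* r) * + (↧ₙ q ℕ.* ↧ₙ r) ≡ (↥ q * ↥ r) * + ↧ₙ (q ℚ.* r)
↥*↧ q@(mkℚ _ _ _) r@(mkℚ _ _ _) with ℚP.toℚᵘ-homo-* q r
... | ℚᵘ.*≡* eq = trans (cong (_* + (↧ₙ q ℕ.* ↧ₙ r)) (sym (numerator (q ℚ.* r)))) (trans eq (cong (↥ q * ↥ r *_) (denominator (q ℚ.* r))))
  where
  numerator : ∀ x → ℚᵘ.↥ (ℚ.toℚᵘ x) ≡ ↥ x
  numerator (mkℚ _ _ _) = refl
  denominator : ∀ x → ℚᵘ.↧ (ℚ.toℚᵘ x) ≡ + ↧ₙ x
  denominator (mkℚ _ _ _) = refl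

↧ₙ≢0 : ∀ q → ↧ₙ q ≢ 0
↧ₙ≢0 (mkℚ _ _ _) ()

↧ₙ*↧ₙ≢0 : ∀ q r → ↧ₙ q ℕ.* ↧ₙ r ≢ 0
↧ₙ*↧ₙ≢0 (mkℚ _ _ _) (mkℚ _ _ _) ()

*≢0 : ∀ {a b} → a ≢ 0ℤ → b ≢ 0ℤ → a * b ≢ 0ℤ
*≢0 {a} a≢0 b≢0 ab≡0 = [ a≢0 , b≢0 ]′ (ℤP.i*j≡0⇒i≡0∨j≡0 a ab≡0)

num-nonzero-* : ∀ q r → NumNonZero q → NumNonZero r → NumNonZero (q ℚ.* r)
num-nonzero-* q r q≢0 r≢0 qr≡0 = *≢0 (*≢0 q≢0 r≢0) (+↧≢0 (↧ₙ≢0 (q ℚ.* r))) (begin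
  ↥ q * ↥ r * + ↧ₙ (q ℚ.* r)      ≡⟨ sym (↥*↧ q r) ⟩
  ↥ (q ℚ.* r) * + (↧ₙ q ℕ.* ↧ₙ r) ≡⟨ cong (_* + (↧ₙ q ℕ.* ↧ₙ r)) qr≡0 ⟩
  0ℤ                              ∎)
  where +↧≢0 : ∀ {d} → d ≢ 0 → + d ≢ 0ℤ
        +↧≢0 d≢0 = d≢0 ∘ ℤP.+-injective

num-nonzero : ∀ q .{{_ : NonZero q}} → NumNonZero q
num-nonzero (mkℚ +[1+ _ ] _ _) ()
num-nonzero (mkℚ -[1+ _ ] _ _) ()

num-nonzero-1/ : ∀ q .{{_ : NonZero q}} → NumNonZero (1/ q)
num-nonzero-1/ (mkℚ +[1+ _ ] _ _) ()
num-nonzero-1/ (mkℚ -[1+ _ ] _ _) ()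

num-nonzero-^ℕ : ∀ q n → NumNonZero q → NumNonZero (q ^ℕ n)
num-nonzero-^ℕ q zero q≢0 = λ ()
num-nonzero-^ℕ q (suc n) q≢0 = num-nonzero-* q (q ^ℕ n) q≢0 (num-nonzero-^ℕ q n q≢0)

num-nonzero-zpow : ∀ q .{{_ : NonZero q}} e → NumNonZero (zpow q e)
num-nonzero-zpow q (+ n) = num-nonzero-^ℕ q n (num-nonzero q)
num-nonzero-zpow q -[1+ n ] = num-nonzero-^ℕ (1/ q) (suc n) (num-nonzero-1/ q)

num-nonzero-monomial : ∀ k a nz x → NumNonZero (monomial k a nz x)
num-nonzero-monomial zero a nz x = λ ()
num-nonzero-monomial (suc k) a nz x =
  num-nonzero-* (zpow (a zero) {{nz zero}} (x zero)) (monomial k (a ∘ suc) (nz ∘ suc) (x ∘ suc)) (num-nonzero-zpow (a zero) {{nz zero}} (x zero)) (num-nonzero-monomial k (a ∘ suc) (nz ∘ suc) (x ∘ suc))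

module Homomorphism (M : ℤ) (h : ℚ → ℤ)
  (h-* : ∀ q r → NumNonZero q → NumNonZero r → h (q ℚ.* r) ≡ h q + h r [mod M ])
  (h-1 : h 1ℚ ≡ 0ℤ [mod M ])
  (h-1/ : ∀ q .{{_ : NonZero q}} → h (1/ q) ≡ - h q [mod M ]) where

  h-^ℕ : ∀ q n → NumNonZero q → h (q ^ℕ n) ≡ + n * h q [mod M ]
  h-^ℕ q zero q≢0 = mod-trans h-1 (≡⇒≡mod (sym (ℤP.*-zeroˡ (h q))))
  h-^ℕ q (suc n) q≢0 =
    mod-trans (h-* q (q ^ℕ n) q≢0 (num-nonzero-^ℕ q n q≢0))
      (mod-trans (mod-+ (≡⇒≡mod {a = h q} refl) (h-^ℕ q n q≢0)) (≡⇒≡mod (sym (ℤP.suc-* (+ n) (h q)))))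

  h-zpow : ∀ q .{{_ : NonZero q}} e → h (zpow q e) ≡ e * h q [mod M ]
  h-zpow q (+ n) = h-^ℕ q n (num-nonzero q)
  h-zpow q -[1+ n ] =
    mod-trans (h-^ℕ (1/ q) (suc n) (num-nonzero-1/ q))
      (mod-trans (mod-*ˡ (+ suc n) (h-1/ q)) (≡⇒≡mod (trans (sym (ℤP.neg-distribʳ-* (+ suc n) (h q))) (ℤP.neg-distribˡ-* (+ suc n) (h q)))))

  h-monomial : ∀ k a nz x → h (monomial k a nz x) ≡ x · (h ∘ a) [mod M ]
  h-monomial zero a nz x = h-1
  h-monomial (suc k) a nz x =
    mod-trans (h-* (zpow (a zero) {{nz zero}} (x zero)) (monomial k (a ∘ suc) (nz ∘ suc) (x ∘ suc)) (num-nonzero-zpow (a zero) {{nz zero}} (x zero)) (num-nonzero-monomial k (a ∘ suc) (nz ∘ suc) (x ∘ suc)))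
      (mod-+ (h-zpow (a zero) {{nz zero}} (x zero)) (h-monomial k (a ∘ suc) (nz ∘ suc) (x ∘ suc)))

diff≡diff⇔sum≡sum : ∀ a b c d → (+ a - + b ≡ + c - + d → a ℕ.+ d ≡ c ℕ.+ b) × (a ℕ.+ d ≡ c ℕ.+ b → + a - + b ≡ + c - + d)
diff≡diff⇔sum≡sum a b c d = to , from
  where
  to : + a - + b ≡ + c - + d → a ℕ.+ d ≡ c ℕ.+ b
  to eq = ℤP.+-injective (begin
    + (a ℕ.+ d)         ≡⟨ ℤP.pos-+ a d ⟩
    + a + + d           ≡⟨ split (+ a) (+ b) (+ d) ⟩
    (+ a - + b) + + b + + d ≡⟨ cong (λ x → x + + b + + d) eq ⟩
    (+ c - + d) + + b + + d ≡⟨ merge (+ c) (+ d) (+ b) ⟩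
    + c + + b           ≡⟨ sym (ℤP.pos-+ c b) ⟩
    + (c ℕ.+ b)         ∎)
    where split : ∀ a b d → a + d ≡ (a - b) + b + d
          split = solve-∀
          merge : ∀ c d b → (c - d) + b + d ≡ c + b
          merge = solve-∀
  from : a ℕ.+ d ≡ c ℕ.+ b → + a - + b ≡ + c - + d
  from eq = begin
    + a - + b                   ≡⟨ split (+ a) (+ b) (+ d) ⟩
    (+ a + + d) - + b - + d     ≡⟨ cong (λ x → x - + b - + d) (trans (sym (ℤP.pos-+ a d)) (trans (cong +_ eq) (ℤP.pos-+ c b))) ⟩
    (+ c + + b) - + b - + d     ≡⟨ merge (+ c) (+ b) (+ d) ⟩
    + c - + d                   ∎
    where split : ∀ a b d → a - b ≡ (a + d) - b - d
          split = solve-∀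
          merge : ∀ c b d → (c + b) - b - d ≡ c - d
          merge = solve-∀

∣∣≢0 : ∀ {a} → a ≢ 0ℤ → ∣ a ∣ ≢ 0
∣∣≢0 a≢0 = a≢0 ∘ ℤP.∣i∣≡0⇒i≡0

module RationalValuation {p} (p-prime : Prime p) where
  open AtPrime p-prime

  fraction-val : ℤ → ℕ → ℤ
  fraction-val a d = + val ∣ a ∣ - + val d

  fraction-val-cross : ∀ {a b d d'} → a ≢ 0ℤ → b ≢ 0ℤ → d ≢ 0 → d' ≢ 0 →
    a * + d ≡ b * + d' → fraction-val a d' ≡ fraction-val b d
  fraction-val-cross {a} {b} {d} {d'} a≢0 b≢0 d≢0 d'≢0 ad≡bd' = proj₂ (diff≡diff⇔sum≡sum (val ∣ a ∣) (val d') (val ∣ b ∣) (val d)) (begin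
    val ∣ a ∣ ℕ.+ val d    ≡⟨ sym (val-* p-prime (∣∣≢0 a≢0) d≢0) ⟩
    val (∣ a ∣ ℕ.* d)      ≡⟨ cong val (trans (sym (ℤP.abs-* a (+ d))) (trans (cong ∣_∣ ad≡bd') (ℤP.abs-* b (+ d')))) ⟩
    val (∣ b ∣ ℕ.* d')     ≡⟨ val-* p-prime (∣∣≢0 b≢0) d'≢0 ⟩
    val ∣ b ∣ ℕ.+ val d'   ∎)

  v : ℚ → ℤ
  v q = fraction-val (↥ q) (↧ₙ q)

  v-* : ∀ q r → NumNonZero q → NumNonZero r → v (q ℚ.* r) ≡ v q + v r
  v-* q r q≢0 r≢0 = begin
    v (q ℚ.* r)
      ≡⟨ fraction-val-cross (num-nonzero-* q r q≢0 r≢0) (*≢0 q≢0 r≢0) (↧ₙ*↧ₙ≢0 q r) (↧ₙ≢0 (q ℚ.* r)) (↥*↧ q r) ⟩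
    + val ∣ ↥ q * ↥ r ∣ - + val (↧ₙ q ℕ.* ↧ₙ r)
      ≡⟨ cong₂ (λ a b → + a - + b) (trans (cong val (ℤP.abs-* (↥ q) (↥ r))) (val-* p-prime (∣∣≢0 q≢0) (∣∣≢0 r≢0)))
                                     (val-* p-prime (↧ₙ≢0 q) (↧ₙ≢0 r)) ⟩
    + (val ∣ ↥ q ∣ ℕ.+ val ∣ ↥ r ∣) - + (val (↧ₙ q) ℕ.+ val (↧ₙ r))
      ≡⟨ cong₂ _-_ (ℤP.pos-+ (val ∣ ↥ q ∣) (val ∣ ↥ r ∣)) (ℤP.pos-+ (val (↧ₙ q)) (val (↧ₙ r))) ⟩
    (+ val ∣ ↥ q ∣ + + val ∣ ↥ r ∣) - (+ val (↧ₙ q) + + val (↧ₙ r))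
      ≡⟨ regroup (+ val ∣ ↥ q ∣) (+ val ∣ ↥ r ∣) (+ val (↧ₙ q)) (+ val (↧ₙ r)) ⟩
    v q + v r ∎
    where regroup : ∀ a b c d → (a + b) - (c + d) ≡ (a - c) + (b - d)
          regroup = solve-∀

  v-1 : v 1ℚ ≡ 0ℤ
  v-1 = cong (λ e → + e - + e) val-1

  v-1/ : ∀ q .{{_ : NonZero q}} → v (1/ q) ≡ - v q
  v-1/ (mkℚ +[1+ n ] d _) = flip (+ val (suc d)) (+ val (suc n))
    where flip : ∀ a b → a - b ≡ - (b - a)
          flip = solve-∀
  v-1/ (mkℚ -[1+ n ] d _) = flip (+ val (suc d)) (+ val (suc n))
    where flip : ∀ a b → a - b ≡ - (b - a)
          flip = solve-∀

  -- v is multiplicative on the nose (modulus 0).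
  module Hom = Homomorphism 0ℤ v (λ q r q≢0 r≢0 → ≡⇒≡mod (v-* q r q≢0 r≢0)) (≡⇒≡mod v-1) (λ q → ≡⇒≡mod (v-1/ q))

  v-zpow : ∀ q .{{_ : NonZero q}} e → v (zpow q e) ≡ e * v q
  v-zpow q e = mod0⇒≡ (Hom.h-zpow q e)

  v-monomial : ∀ k a nz x → v (monomial k a nz x) ≡ x · (v ∘ a)
  v-monomial k a nz x = mod0⇒≡ (Hom.h-monomial k a nz x)

sign-bit : ℤ → ℤ
sign-bit (+ _) = 0ℤ
sign-bit -[1+ _ ] = 1ℤ

sign-bit-is-bit : ∀ a → Bit (sign-bit a)
sign-bit-is-bit (+ _) = inj₁ refl
sign-bit-is-bit -[1+ _ ] = inj₂ refl

sign-bit-*-pos : ∀ a d → .{{ℕ.NonZero d}} → sign-bit (a * + d) ≡ sign-bit a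
sign-bit-*-pos (+ zero) (suc _) = refl
sign-bit-*-pos +[1+ _ ] (suc _) = refl
sign-bit-*-pos -[1+ _ ] (suc _) = refl

sign-bit-* : ∀ {a b} → a ≢ 0ℤ → b ≢ 0ℤ → sign-bit (a * b) ≡ sign-bit a + sign-bit b [mod + 2 ]
sign-bit-* {+ zero} a≢0 _ = ⊥-elim (a≢0 refl)
sign-bit-* {_} {+ zero} _ b≢0 = ⊥-elim (b≢0 refl)
sign-bit-* {+[1+ _ ]} {+[1+ _ ]} _ _ = ≡⇒≡mod refl
sign-bit-* {+[1+ _ ]} { -[1+ _ ]} _ _ = ≡⇒≡mod refl
sign-bit-* { -[1+ _ ]} {+[1+ _ ]} _ _ = ≡⇒≡mod refl
sign-bit-* { -[1+ _ ]} { -[1+ _ ]} _ _ = congruent (- 1ℤ) refl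

abs-sign-bit-injective : ∀ {a b} → ∣ a ∣ ≡ ∣ b ∣ → sign-bit a ≡ sign-bit b → a ≡ b
abs-sign-bit-injective {+ _} {+ _} ∣a∣≡∣b∣ _ = cong +_ ∣a∣≡∣b∣
abs-sign-bit-injective { -[1+ _ ]} { -[1+ _ ]} ∣a∣≡∣b∣ _ = cong -[1+_] (ℕP.suc-injective ∣a∣≡∣b∣)
abs-sign-bit-injective {+ _} { -[1+ _ ]} _ ()
abs-sign-bit-injective { -[1+ _ ]} {+ _} _ ()

sgn : ℚ → ℤ
sgn q = sign-bit (↥ q)

sgn-* : ∀ q r → NumNonZero q → NumNonZero r → sgn (q ℚ.* r) ≡ sgn q + sgn r [mod + 2 ]
sgn-* q r q≢0 r≢0 = mod-trans (≡⇒≡mod (begin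
  sign-bit (↥ (q ℚ.* r))                        ≡⟨ sym (sign-bit-*-pos (↥ (q ℚ.* r)) (↧ₙ q ℕ.* ↧ₙ r) {{ℕ.≢-nonZero (↧ₙ*↧ₙ≢0 q r)}}) ⟩
  sign-bit (↥ (q ℚ.* r) * + (↧ₙ q ℕ.* ↧ₙ r))     ≡⟨ cong sign-bit (↥*↧ q r) ⟩
  sign-bit (↥ q * ↥ r * + ↧ₙ (q ℚ.* r))          ≡⟨ sign-bit-*-pos (↥ q * ↥ r) (↧ₙ (q ℚ.* r)) {{ℕ.≢-nonZero (↧ₙ≢0 (q ℚ.* r))}} ⟩
  sign-bit (↥ q * ↥ r)                          ∎)) (sign-bit-* q≢0 r≢0)

sgn-1/ : ∀ q .{{_ : NonZero q}} → sgn (1/ q) ≡ - sgn q [mod + 2 ]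
sgn-1/ (mkℚ +[1+ _ ] _ _) = ≡⇒≡mod refl
sgn-1/ (mkℚ -[1+ _ ] _ _) = congruent 1ℤ refl

module Sign = Homomorphism (+ 2) sgn sgn-* (≡⇒≡mod refl) sgn-1/

-- A non-zero rational is determined by its valuations at all primes and its sign:
-- for X = n₁/d₁ and Y = n₂/d₂ the numbers ∣n₁∣d₂ and ∣n₂∣d₁ have the same valuations.
rational-determined : ∀ {X Y} → NumNonZero X → NumNonZero Y →
  (∀ {p} (p-prime : Prime p) → RationalValuation.v p-prime X ≡ RationalValuation.v p-prime Y) →
  sgn X ≡ sgn Y → X ≡ Y
rational-determined {mkℚ n₁ d₁ _} {mkℚ n₂ d₂ _} n₁≢0 n₂≢0 same-v same-sgn = ℚP.≃⇒≡ (ℚ.*≡* cross)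
  where
  ∣n₁∣d₂≡∣n₂∣d₁ : ∣ n₁ ∣ ℕ.* suc d₂ ≡ ∣ n₂ ∣ ℕ.* suc d₁
  ∣n₁∣d₂≡∣n₂∣d₁ = valuations-determine (*≢0ℕ (∣∣≢0 n₁≢0)) (*≢0ℕ (∣∣≢0 n₂≢0)) λ p-prime → let open AtPrime p-prime in begin
    val (∣ n₁ ∣ ℕ.* suc d₂)     ≡⟨ val-* p-prime (∣∣≢0 n₁≢0) (λ ()) ⟩
    val ∣ n₁ ∣ ℕ.+ val (suc d₂) ≡⟨ proj₁ (diff≡diff⇔sum≡sum (val ∣ n₁ ∣) (val (suc d₁)) (val ∣ n₂ ∣) (val (suc d₂))) (same-v p-prime) ⟩
    val ∣ n₂ ∣ ℕ.+ val (suc d₁) ≡⟨ sym (val-* p-prime (∣∣≢0 n₂≢0) (λ ())) ⟩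
    val (∣ n₂ ∣ ℕ.* suc d₁)     ∎
    where *≢0ℕ : ∀ {m d} → m ≢ 0 → m ℕ.* suc d ≢ 0
          *≢0ℕ {m} m≢0 md≡0 = [ m≢0 , (λ ()) ]′ (ℕP.m*n≡0⇒m≡0∨n≡0 m md≡0)
  cross : n₁ * + suc d₂ ≡ n₂ * + suc d₁
  cross = abs-sign-bit-injective
    (trans (ℤP.abs-* n₁ (+ suc d₂)) (trans ∣n₁∣d₂≡∣n₂∣d₁ (sym (ℤP.abs-* n₂ (+ suc d₁)))))
    (trans (sign-bit-*-pos n₁ (suc d₂)) (trans same-sgn (sym (sign-bit-*-pos n₂ (suc d₁)))))

val-at : ℕ → ℚ → ℤ
val-at p q with prime? p
... | yes p-prime = RationalValuation.v p-prime q
... | no _ = 0ℤ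

-- Irrelevance of the non-triviality instance makes this hold by definition.
val-at-prime : ∀ {p} (p-prime : Prime p) q → val-at p q ≡ RationalValuation.v p-prime q
val-at-prime {p} p-prime q with prime? p
... | yes _ = refl
... | no ¬p-prime = ⊥-elim (¬p-prime p-prime)

val-at-1 : ∀ p → val-at p 1ℚ ≡ 0ℤ
val-at-1 p with prime? p
... | yes p-prime = RationalValuation.v-1 p-prime
... | no _ = refl

val-at-monomial : ∀ p k a nz x → val-at p (monomial k a nz x) ≡ x · (λ j → val-at p (a j))
val-at-monomial p k a nz x with prime? p
... | yes p-prime = RationalValuation.v-monomial p-prime k a nz x
... | no _ = sym (·-zeroʳ x (λ _ → refl))

height : ∀ k → (Fin k → ℚ) → ℕ
height zero a = 0
height (suc k) a = ∣ ↥ a zero ∣ ℕ.+ ↧ₙ (a zero) ℕ.+ height k (a ∘ suc)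

height-≥ : ∀ k a (j : Fin k) → ∣ ↥ a j ∣ ℕ.+ ↧ₙ (a j) ℕ.≤ height k a
height-≥ (suc k) a zero = ℕP.m≤m+n _ (height k (a ∘ suc))
height-≥ (suc k) a (suc j) = ℕP.≤-trans (height-≥ k (a ∘ suc) j) (ℕP.m≤n+m _ (∣ ↥ a zero ∣ ℕ.+ ↧ₙ (a zero)))

val-at-beyond : ∀ {p} k a (nz : ∀ i → NonZero (a i)) → height k a ℕ.< p → ∀ j → val-at p (a j) ≡ 0ℤ
val-at-beyond {p} k a nz h<p j with prime? p
... | no _ = refl
... | yes p-prime = cong₂ (λ m n → + m - + n)
  (val-small (∣∣≢0 (num-nonzero (a j) {{nz j}})) (below (ℕP.m≤m+n ∣ ↥ a j ∣ (↧ₙ (a j)))))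
  (val-small (↧ₙ≢0 (a j)) (below (ℕP.m≤n+m (↧ₙ (a j)) ∣ ↥ a j ∣)))
  where
  open AtPrime p-prime using (val-small)
  below : ∀ {m} → m ℕ.≤ ∣ ↥ a j ∣ ℕ.+ ↧ₙ (a j) → m ℕ.< p
  below m≤ = ℕP.≤-<-trans (ℕP.≤-trans m≤ (height-≥ k a j)) h<p

module Assembly (k : ℕ) (a : Fin k → ℚ) (nz : ∀ i → NonZero (a i)) where

  mon : (Fin k → ℤ) → ℚ
  mon = monomial k a nz

  column : ℕ → Fin k → ℤ
  column p j = val-at p (a j)

  V : Fin k → Fin (suc (height k a)) → ℤ
  V j r = column (toℕ r) j

  relation⇒orthogonal : ∀ {x} → IsRelation V x → ∀ p → x · column p ≡ 0ℤ
  relation⇒orthogonal {x} x-rel p with p ℕ.<? suc (height k a)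
  ... | yes p<B = subst (λ c → x · c ≡ 0ℤ) (cong column (FinP.toℕ-fromℕ< p<B)) (x-rel (fromℕ< p<B))
  ... | no p≮B = ·-zeroʳ x (val-at-beyond k a nz (ℕP.≮⇒≥ p≮B))

  -- For a relation x, the monomial ∏ aⱼ^{xⱼ} has all valuations 0, so it is ±1;
  -- excluding −1, its sign is +, so the signs of the aⱼ satisfy x modulo 2.
  relation⇒even-sign : (∀ x → mon x ≢ ℚ.- 1ℚ) → ∀ {x} → IsRelation V x → x · (sgn ∘ a) ≡ 0ℤ [mod + 2 ]
  relation⇒even-sign no-minus-one {x} x-rel with sign-bit-is-bit (↥ mon x)
  ... | inj₁ sgn≡0 = mod-trans (mod-sym (Sign.h-monomial k a nz x)) (≡⇒≡mod sgn≡0)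
  ... | inj₂ sgn≡1 = ⊥-elim (no-minus-one x (rational-determined (num-nonzero-monomial k a nz x) (λ ()) trivial-valuations sgn≡1))
    where
    trivial-valuations : ∀ {p} (p-prime : Prime p) → RationalValuation.v p-prime (mon x) ≡ RationalValuation.v p-prime (ℚ.- 1ℚ)
    trivial-valuations {p} p-prime = begin
      RationalValuation.v p-prime (mon x) ≡⟨ sym (val-at-prime p-prime (mon x)) ⟩
      val-at p (mon x)                    ≡⟨ val-at-monomial p k a nz x ⟩
      x · column p                        ≡⟨ relation⇒orthogonal x-rel p ⟩
      0ℤ                                  ≡⟨ sym (RationalValuation.v-1 p-prime) ⟩
      RationalValuation.v p-prime (ℚ.- 1ℚ) ∎

  monomial≡1⇒relation : ∀ x → mon x ≡ 1ℚ → IsRelation V x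
  monomial≡1⇒relation x mon≡1 r = begin
    x · col V r             ≡⟨ sym (val-at-monomial (toℕ r) k a nz x) ⟩
    val-at (toℕ r) (mon x)  ≡⟨ cong (val-at (toℕ r)) mon≡1 ⟩
    val-at (toℕ r) 1ℚ       ≡⟨ val-at-1 (toℕ r) ⟩
    0ℤ                      ∎

  -- If e·Vᵢ = y·V then aᵢᵉ and ∏ aⱼ^{yⱼ} have the same valuations and sign, hence are equal.
  power≡monomial : (∀ x → mon x ≢ ℚ.- 1ℚ) → ∀ i e y → (∀ r → e * V i r ≡ y · col V r) → zpow (a i) {{nz i}} e ≡ mon y
  power≡monomial no-minus-one i e y rows =
    rational-determined (num-nonzero-zpow (a i) {{nz i}} e) (num-nonzero-monomial k a nz y) same-valuations same-sign
    where
    instance _ = nz i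

    z-rel : IsRelation V (subtract-at i e y)
    z-rel r = begin
      subtract-at i e y · col V r   ≡⟨ ·-subtract-at i e y (col V r) ⟩
      y · col V r - e * V i r       ≡⟨ cong (λ c → y · col V r - c) (rows r) ⟩
      y · col V r - y · col V r     ≡⟨ ℤP.+-inverseʳ (y · col V r) ⟩
      0ℤ                            ∎

    same-valuations : ∀ {p} (p-prime : Prime p) → RationalValuation.v p-prime (zpow (a i) e) ≡ RationalValuation.v p-prime (mon y)
    same-valuations {p} p-prime = begin
      v (zpow (a i) e)     ≡⟨ v-zpow (a i) e ⟩
      e * v (a i)          ≡⟨ cong (e *_) (sym (val-at-prime p-prime (a i))) ⟩
      e * column p i       ≡⟨ mod0⇒≡ (subtract-at-orthogonal i e y (column p) (≡⇒≡mod (relation⇒orthogonal z-rel p))) ⟩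
      y · column p         ≡⟨ sym (val-at-monomial p k a nz y) ⟩
      val-at p (mon y)     ≡⟨ val-at-prime p-prime (mon y) ⟩
      v (mon y)            ∎
      where open RationalValuation p-prime using (v; v-zpow)

    same-sign : sgn (zpow (a i) e) ≡ sgn (mon y)
    same-sign = bits-mod2 (sign-bit-is-bit _) (sign-bit-is-bit _) (mod-trans (Sign.h-zpow (a i) e)
      (mod-trans (subtract-at-orthogonal i e y (sgn ∘ a) (relation⇒even-sign no-minus-one z-rel))
                 (mod-sym (Sign.h-monomial k a nz y))))

lemma5p1 : (k : ℕ) (a : Fin k → ℚ) (nz : ∀ i → NonZero (a i)) →
    (∀ (x : Fin k → ℤ) → monomial k a nz x ≢ ℚ.- 1ℚ) →
    Σ (Subset k) λ S →
      (∀ (x : Fin k → ℤ) → (∀ j → j ∉ S → x j ≡ + 0) →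
         monomial k a nz x ≡ 1ℚ → ∀ j → x j ≡ + 0)
      ×
      (∀ i → Σ ℤ λ e → (∃ λ (m : ℤ) → e ≡ + 2 * m + + 1) ×
         Σ (Fin k → ℤ) λ y → (∀ j → j ∉ S → y j ≡ + 0) ×
           zpow (a i) {{nz i}} e ≡ monomial k a nz y)
lemma5p1 k a nz no-minus-one with eliminate (suc (height k a)) (Assembly.V k a nz)
... | S , independent , spanned = S ,
  (λ x x-supp mon≡1 → independent x x-supp (monomial≡1⇒relation x mon≡1)) ,
  λ i → let (e , e-odd , y , y-supp , rows) = spanned i in e , e-odd , y , y-supp , power≡monomial no-minus-one i e y rows
  where open Assembly k a nz
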